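{- Let $M$ be a matroid on a finite set $E$, let $\underline{x}=\{x_e:e\in E\}$ and $\underline{y}=\{y_e:e\in E\}$ be families of commuting indeterminates indexed by $E$, and let $\xi$ be an indeterminate. Then $$ \mathbf{SC} (M; \underline{xy},\xi) = \sum_{T:\, T \subseteq E} \underline{(x+1)}^T\, \underline{y}^T\, \mathbf{SC} (M/T;\underline{ -y},\xi). $$
   Context: For a matroid $N$ of rank $s$ on a set $F$ with rank function $\mathrm{rk}_N$ and a family $\underline{z}=\{z_e:e\in F\}$, the subset-corank polynomial is $\mathbf{SC}(N;\underline{z},\lambda)=\sum_{A\subseteq F}\underline{z}^A\lambda^{s-\mathrm{rk}_N(A)}$, where $\underline{z}^A=\prod_{e\in A}z_e$. Notation: $\underline{xy}=\{x_ey_e\}$, $\underline{ -y}=\{ -y_e\}$, $\underline{(x+1)}^T=\prod_{e\in T}(x_e+1)$, $\underline{y}^T=\prod_{e\in T}y_e$; families are restricted to the ground set of the matroid in question. $M/T$ is the contraction of $M$ by $T$, a matroid on $E\setminus T$ of rank $\mathrm{rk}(E)-\mathrm{rk}(T)$ with rank function $A\mapsto\mathrm{rk}(A\cup T)-\mathrm{rk}(T)$. -}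

module Defs where

open import Level using (Level)
open import Data.Nat using (ℕ; zero; suc; _≤_; _∸_)
import Data.Nat as N
open import Data.Fin using (Fin)
import Data.Fin as F
open import Data.Fin.Subset using (Subset; Side; inside; outside; _∪_; _∩_; ∣_∣; _⊆_; ⊥; ⊤; ∁)
open import Data.Vec using (Vec; []; _∷_)
open import Data.List using (List; []; _∷_; map; _++_; foldr)
open import Relation.Binary.PropositionalEquality using (_≡_)
open import Algebra.Bundles using (CommutativeRing)

record Matroid (n : ℕ) : Set where
  field
    rk          : Subset n → ℕ
    rk-empty    : rk ⊥ ≡ 0
    rk-card     : ∀ A → rk A ≤ ∣ A ∣
    rk-mono     : ∀ {A B} → A ⊆ B → rk A ≤ rk B
    rk-submod   : ∀ A B → rk (A ∪ B) N.+ rk (A ∩ B) ≤ rk A N.+ rk B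

subsetsOf : ∀ {n} → Subset n → List (Subset n)
subsetsOf []            = [] ∷ []
subsetsOf (outside ∷ G) = map (outside ∷_) (subsetsOf G)
subsetsOf (inside  ∷ G) = map (outside ∷_) (subsetsOf G) ++ map (inside ∷_) (subsetsOf G)

module Poly {c ℓ : Level} (R : CommutativeRing c ℓ) where
  open CommutativeRing R

  pow : Carrier → ℕ → Carrier
  pow a zero    = 1#
  pow a (suc k) = a * pow a k

  sumL : List Carrier → Carrier
  sumL = foldr _+_ 0#

  mono : ∀ {n} → (Fin n → Carrier) → Subset n → Carrier
  mono z []              = 1#
  mono z (outside ∷ A)   = mono (λ i → z (F.suc i)) A
  mono z (inside  ∷ A)   = z F.zero * mono (λ i → z (F.suc i)) A

  -- Subset-corank polynomial of a matroid with ground set G ⊆ Fin n and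
  -- rank function r (on subsets of G); its rank is r G:
  --   SC = Σ_{A ⊆ G} z^A λ^{r G - r A}
  SCon : ∀ {n} → Subset n → (Subset n → ℕ) → (Fin n → Carrier) → Carrier → Carrier
  SCon G r z λ' = sumL (map (λ A → mono z A * pow λ' (r G ∸ r A)) (subsetsOf G))

  SC : ∀ {n} → Matroid n → (Fin n → Carrier) → Carrier → Carrier
  SC M = SCon ⊤ (Matroid.rk M)

  -- SC(M/T; z, λ): M/T is the matroid on E \ T with rank function
  -- A ↦ rk(A ∪ T) - rk(T); its rank is rk(E) - rk(T) = its rank of E \ T.
  contractRk : ∀ {n} → Matroid n → Subset n → Subset n → ℕ
  contractRk M T A = Matroid.rk M (A ∪ T) ∸ Matroid.rk M T

  SCcontract : ∀ {n} → Matroid n → Subset n → (Fin n → Carrier) → Carrier → Carrier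
  SCcontract M T = SCon (∁ T) (contractRk M T)

module Submission where

-- Split every weight x_e y_e as a_e + b_e with a_e = (x_e + 1) y_e
-- and b_e = -y_e.  Expanding the product (a + b)^B over B gives, for ANY
-- coefficient function g on subsets, the subset-expansion identity
--     Σ_{B ⊆ E} (a+b)^B g(B)  =  Σ_{T ⊆ E} a^T Σ_{A ⊆ E∖T} b^A g(A ∪ T),
-- proved by induction on the ground set, peeling off one element at a time.
-- The matroid enters only through g(B) = ξ^{rk E - rk B}: by monotonicity of
-- rk, the corank of A in M/T equals rk E - rk(A ∪ T), so the inner sum is
-- exactly SC(M/T; -y, ξ).

open import Defs
open import Level using (Level)
open import Data.Nat using (ℕ)
open import Data.Fin using (Fin)
open import Data.Fin.Subset using (Subset; ⊤)
open import Data.List using (map)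
open import Algebra.Bundles using (CommutativeRing)

import Data.Nat as N
import Data.Nat.Properties as NP
import Data.Fin as F
open import Data.Fin.Subset using (inside; outside; _∪_; ∁)
open import Data.Fin.Subset.Properties using (q⊆p∪q; ∪-comm; p∪∁p≡⊤)
open import Data.Vec using ([]; _∷_)
open import Data.List using (List; []; _∷_; _++_)
import Data.List.Properties as LP
open import Relation.Binary.PropositionalEquality as P using (_≡_)
import Relation.Binary.Reasoning.Setoid as SetoidReasoning
import Algebra.Properties.CommutativeSemigroup as CommSemigroupProperties

∸-∸-cancel : ∀ a b c → c N.≤ b → (a N.∸ c) N.∸ (b N.∸ c) ≡ a N.∸ b
∸-∸-cancel a b c c≤b =
  P.trans (NP.∸-+-assoc a c (b N.∸ c)) (P.cong (a N.∸_) (NP.m+[n∸m]≡n c≤b))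

contract-corank : ∀ {n} (M : Matroid n) (T A : Subset n) →
  let open Matroid M in
  (rk (∁ T ∪ T) N.∸ rk T) N.∸ (rk (A ∪ T) N.∸ rk T) ≡ rk ⊤ N.∸ rk (A ∪ T)
contract-corank M T A rewrite ∪-comm (∁ T) T | p∪∁p≡⊤ T =
  ∸-∸-cancel (rk ⊤) (rk (A ∪ T)) (rk T) (rk-mono (q⊆p∪q A T))
  where open Matroid M

module SubsetExpansion {c ℓ : Level} (R : CommutativeRing c ℓ) where
  open CommutativeRing R
  open Poly R
  open SetoidReasoning setoid
  open CommSemigroupProperties *-commutativeSemigroup using (interchange; x∙yz≈y∙xz)

  sumMap : ∀ {A : Set} → (A → Carrier) → List A → Carrier
  sumMap h ts = sumL (map h ts)

  sumMap-cong : ∀ {A : Set} {h k : A → Carrier} ts → (∀ t → h t ≈ k t) → sumMap h ts ≈ sumMap k ts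
  sumMap-cong []       h≈k = refl
  sumMap-cong (t ∷ ts) h≈k = +-cong (h≈k t) (sumMap-cong ts h≈k)

  sumMap-++ : ∀ {A : Set} (h : A → Carrier) ts us → sumMap h (ts ++ us) ≈ sumMap h ts + sumMap h us
  sumMap-++ h []       us = sym (+-identityˡ _)
  sumMap-++ h (t ∷ ts) us = trans (+-congˡ (sumMap-++ h ts us)) (sym (+-assoc _ _ _))

  sumMap-map : ∀ {A B : Set} (h : B → Carrier) (f : A → B) ts → sumMap h (map f ts) ≡ sumMap (λ t → h (f t)) ts
  sumMap-map h f ts = P.cong sumL (P.sym (LP.map-∘ ts))

  sumMap-linear : ∀ {A : Set} (h l : A → Carrier) (k : Carrier) ts →
    sumMap (λ t → h t + k * l t) ts ≈ sumMap h ts + k * sumMap l ts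
  sumMap-linear h l k []       = sym (trans (+-congˡ (zeroʳ k)) (+-identityʳ 0#))
  sumMap-linear h l k (t ∷ ts) = begin
    (h t + k * l t) + sumMap (λ s → h s + k * l s) ts ≈⟨ +-congˡ (sumMap-linear h l k ts) ⟩
    (h t + k * l t) + (H + k * L)                      ≈⟨ +-interchange _ _ _ _ ⟩
    (h t + H) + (k * l t + k * L)                      ≈⟨ +-congˡ (sym (distribˡ k _ _)) ⟩
    (h t + H) + k * (l t + L)                          ∎
    where
    H = sumMap h ts
    L = sumMap l ts
    +-interchange = CommSemigroupProperties.interchange +-commutativeSemigroup

  sumMap-scale : ∀ {A : Set} (l : A → Carrier) (k : Carrier) ts →
    sumMap (λ t → k * l t) ts ≈ k * sumMap l ts
  sumMap-scale l k []       = sym (zeroʳ k)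
  sumMap-scale l k (t ∷ ts) = trans (+-congˡ (sumMap-scale l k ts)) (sym (distribˡ k _ _))

  Σ⊆ : ∀ {n} → Subset n → (Subset n → Carrier) → Carrier
  Σ⊆ G h = sumMap h (subsetsOf G)

  weighted : ∀ {n} → Subset n → (Fin n → Carrier) → (Subset n → Carrier) → Carrier
  weighted G z g = Σ⊆ G (λ B → mono z B * g B)

  weighted-cong : ∀ {n} (G : Subset n) z {g h : Subset n → Carrier} →
    (∀ B → g B ≈ h B) → weighted G z g ≈ weighted G z h
  weighted-cong G z g≈h = sumMap-cong (subsetsOf G) (λ B → *-congˡ (g≈h B))

  weighted-linear : ∀ {n} (G : Subset n) z (g h : Subset n → Carrier) k →
    weighted G z (λ B → g B + k * h B) ≈ weighted G z g + k * weighted G z h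
  weighted-linear G z g h k = begin
    Σ⊆ G (λ B → mono z B * (g B + k * h B))         ≈⟨ sumMap-cong (subsetsOf G) (λ B → distribˡ _ _ _) ⟩
    Σ⊆ G (λ B → mono z B * g B + mono z B * (k * h B)) ≈⟨ sumMap-cong (subsetsOf G) (λ B → +-congˡ (x∙yz≈y∙xz _ _ _)) ⟩
    Σ⊆ G (λ B → mono z B * g B + k * (mono z B * h B)) ≈⟨ sumMap-linear _ _ k (subsetsOf G) ⟩
    weighted G z g + k * weighted G z h               ∎

  module _ {n} (z : Fin (ℕ.suc n) → Carrier) (g : Subset (ℕ.suc n) → Carrier) (G : Subset n) where
    private
      z′ : Fin n → Carrier
      z′ i = z (F.suc i)

    weighted-outside : weighted (outside ∷ G) z g ≈ weighted G z′ (λ B → g (outside ∷ B))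
    weighted-outside = reflexive (sumMap-map _ (outside ∷_) (subsetsOf G))

    weighted-inside : weighted (inside ∷ G) z g
      ≈ weighted G z′ (λ B → g (outside ∷ B)) + z F.zero * weighted G z′ (λ B → g (inside ∷ B))
    weighted-inside = begin
      sumMap h (map (outside ∷_) (subsetsOf G) ++ map (inside ∷_) (subsetsOf G))
        ≈⟨ sumMap-++ h (map (outside ∷_) (subsetsOf G)) _ ⟩
      sumMap h (map (outside ∷_) (subsetsOf G)) + sumMap h (map (inside ∷_) (subsetsOf G))
        ≈⟨ reflexive (P.cong₂ _+_ (sumMap-map h _ (subsetsOf G)) (sumMap-map h _ (subsetsOf G))) ⟩
      weighted G z′ (λ B → g (outside ∷ B)) + Σ⊆ G (λ B → (z F.zero * mono z′ B) * g (inside ∷ B))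
        ≈⟨ +-congˡ (trans (sumMap-cong (subsetsOf G) (λ B → *-assoc _ _ _)) (sumMap-scale _ _ (subsetsOf G))) ⟩
      weighted G z′ (λ B → g (outside ∷ B)) + z F.zero * weighted G z′ (λ B → g (inside ∷ B)) ∎
      where
      h = λ B → mono z B * g B

  above : ∀ {n} → (Fin n → Carrier) → (Subset n → Carrier) → Subset n → Carrier
  above b g T = weighted (∁ T) b (λ A → g (A ∪ T))

  expansion : ∀ n (a b : Fin n → Carrier) (g : Subset n → Carrier) →
    weighted ⊤ (λ e → a e + b e) g ≈ weighted ⊤ a (above b g)
  expansion ℕ.zero    a b g = +-congʳ (*-congˡ (sym (trans (+-identityʳ _) (*-identityˡ _))))
  expansion (ℕ.suc n) a b g = begin
    weighted ⊤ (λ e → a e + b e) g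
      ≈⟨ weighted-inside _ g ⊤ ⟩
    weighted ⊤ c′ g₀ + (a₀ + b₀) * weighted ⊤ c′ g₁
      ≈⟨ +-cong (expansion n a′ b′ g₀) (*-congˡ (expansion n a′ b′ g₁)) ⟩
    W₀ + (a₀ + b₀) * W₁
      ≈⟨ regroup W₀ W₁ ⟩
    (W₀ + b₀ * W₁) + a₀ * W₁
      ≈⟨ +-cong (sym (weighted-linear ⊤ a′ _ _ b₀)) (*-congˡ (weighted-cong ⊤ a′ λ T → sym (weighted-outside b _ (∁ T)))) ⟩
    weighted ⊤ a′ (λ T → above b′ g₀ T + b₀ * above b′ g₁ T) + a₀ * weighted ⊤ a′ (λ T → above b g (inside ∷ T))
      ≈⟨ +-congʳ (weighted-cong ⊤ a′ λ T → sym (weighted-inside b _ (∁ T))) ⟩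
    weighted ⊤ a′ (λ T → above b g (outside ∷ T)) + a₀ * weighted ⊤ a′ (λ T → above b g (inside ∷ T))
      ≈⟨ weighted-inside a (above b g) ⊤ ⟨
    weighted ⊤ a (above b g) ∎
    where
    a₀ = a F.zero
    b₀ = b F.zero
    a′ b′ c′ : Fin n → Carrier
    a′ i = a (F.suc i)
    b′ i = b (F.suc i)
    c′ i = a′ i + b′ i
    g₀ g₁ : Subset n → Carrier
    g₀ B = g (outside ∷ B)
    g₁ B = g (inside ∷ B)
    W₀ = weighted ⊤ a′ (above b′ g₀)
    W₁ = weighted ⊤ a′ (above b′ g₁)
    regroup : ∀ w₀ w₁ → w₀ + (a₀ + b₀) * w₁ ≈ (w₀ + b₀ * w₁) + a₀ * w₁
    regroup w₀ w₁ = begin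
      w₀ + (a₀ + b₀) * w₁       ≈⟨ +-congˡ (trans (*-congʳ (+-comm a₀ b₀)) (distribʳ w₁ b₀ a₀)) ⟩
      w₀ + (b₀ * w₁ + a₀ * w₁)  ≈⟨ +-assoc _ _ _ ⟨
      (w₀ + b₀ * w₁) + a₀ * w₁  ∎

  mono-cong : ∀ {n} {z w : Fin n → Carrier} (T : Subset n) → (∀ e → z e ≈ w e) → mono z T ≈ mono w T
  mono-cong []            z≈w = refl
  mono-cong (outside ∷ T) z≈w = mono-cong T (λ e → z≈w (F.suc e))
  mono-cong (inside  ∷ T) z≈w = *-cong (z≈w F.zero) (mono-cong T (λ e → z≈w (F.suc e)))

  mono-* : ∀ {n} (a b : Fin n → Carrier) (T : Subset n) → mono (λ e → a e * b e) T ≈ mono a T * mono b T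
  mono-* a b []            = sym (*-identityˡ 1#)
  mono-* a b (outside ∷ T) = mono-* (λ e → a (F.suc e)) (λ e → b (F.suc e)) T
  mono-* a b (inside  ∷ T) =
    trans (*-congˡ (mono-* (λ e → a (F.suc e)) (λ e → b (F.suc e)) T)) (interchange _ _ _ _)

  xy-split : ∀ u v → u * v ≈ (u + 1#) * v + - v
  xy-split u v = sym (begin
    (u + 1#) * v + - v        ≈⟨ +-congʳ (distribʳ v u 1#) ⟩
    (u * v + 1# * v) + - v    ≈⟨ +-assoc _ _ _ ⟩
    u * v + (1# * v + - v)    ≈⟨ +-congˡ (trans (+-congʳ (*-identityˡ v)) (-‿inverseʳ v)) ⟩
    u * v + 0#                ≈⟨ +-identityʳ _ ⟩
    u * v                     ∎)

mainTheorem3 : {c ℓ : Level} (R : CommutativeRing c ℓ) (n : ℕ) (M : Matroid n)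
    (x y : Fin n → CommutativeRing.Carrier R) (ξ : CommutativeRing.Carrier R) →
    let open CommutativeRing R in
    let open Poly R in
    SC M (λ e → x e * y e) ξ
    ≈ sumL (map (λ T → mono (λ e → x e + 1#) T * mono y T * SCcontract M T (λ e → - y e) ξ) (subsetsOf ⊤))
mainTheorem3 R n M x y ξ = begin
  weighted ⊤ (λ e → x e * y e) corank
    ≈⟨ sumMap-cong (subsetsOf ⊤) (λ B → *-congʳ (mono-cong B (λ e → xy-split (x e) (y e)))) ⟩
  weighted ⊤ (λ e → a e + b e) corank
    ≈⟨ expansion n a b corank ⟩
  weighted ⊤ a (above b corank)
    ≈⟨ sumMap-cong (subsetsOf ⊤) (λ T → *-cong (mono-* _ y T) (contraction T)) ⟩
  sumL (map (λ T → mono (λ e → x e + 1#) T * mono y T * SCcontract M T b ξ) (subsetsOf ⊤)) ∎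
  where
  open CommutativeRing R
  open Poly R
  open SubsetExpansion R
  open Matroid M
  open SetoidReasoning setoid
  a b : Fin n → Carrier
  a e = (x e + 1#) * y e
  b e = - y e
  corank : Subset n → Carrier
  corank B = pow ξ (rk ⊤ N.∸ rk B)
  contraction : ∀ T → above b corank T ≈ SCcontract M T b ξ
  contraction T = weighted-cong (∁ T) b λ A → reflexive (P.cong (pow ξ) (P.sym (contract-corank M T A)))
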